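{- Assume the rules for $\mathrm{W}$-types, and let $W:=(\mathrm{W}x:A)B(x)$ with its $P$-algebra structure $\sup_W:PW\to W$ given by the introduction rule. For a small $P$-algebra $C=(C,\sup_C)$, the following are equivalent: (i) $C$ is inductive; (ii) $C$ is homotopy-initial; (iii) there is a $P$-algebra equivalence between $C$ and $(W,\sup_W)$. In particular, $(W,\sup_W)$ is a homotopy-initial $P$-algebra.
   Context: Work in the intensional Martin-Löf type theory $\mathcal{H}$ with $\Sigma$-types, $\Pi$-types (with judgemental $\eta$), identity types and a universe $\mathsf{U}$ (à la Russell) closed under $\Sigma,\Pi,\mathsf{Id}$, together with function extensionality; no UIP or equality reflection. Paths are elements of identity types; $\mathsf{iscontr}(X):=(\Sigma x:X)(\Pi y:X)\mathsf{Id}(x,y)$. Composition of paths $p:\mathsf{Id}(a,b)$, $q:\mathsf{Id}(b,c)$ is written $q\cdot p$; for $f$ a function and $p$ a path, $f\circ p$ is the induced path. Rules for $\mathrm{W}$-types: for $A:\mathsf{type}$, $B(x):\mathsf{type}$ ($x:A$) there is a type $W=(\mathrm{W}x:A)B(x)$, small whenever $A,B$ are small, with introduction $\sup(a,t):W$ for $a:A$, $t:B(a)\to W$; elimination: for any $E(w)$ ($w:W$) and $e(x,u,v):E(\sup(x,u))$ for $x:A$, $u:B(x)\to W$, $v:(\Pi y:B(x))E(uy)$, there is $\mathsf{elim}(w,e):E(w)$, with judgemental computation $\mathsf{elim}(\sup(x,u),e)=e(x,u,\lambda y.\mathsf{elim}(uy,e))$. Fix $A:\mathsf{U}$, $B:A\to\mathsf{U}$;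 $PC:=(\Sigma x:A)(B(x)\to C)$, $Pf(x,u)=(x,f\circ u)$ (defined by $\Sigma$-elimination). $P$-algebra: $(C,\sup_C)$ with $C:\mathsf{U}$, $\sup_C:PC\to C$; $\mathsf{Alg}$ is the type of these. Morphisms: $\mathsf{Alg}(C,D):=(\Sigma f:C\to D)\mathsf{Id}(f\circ\sup_C,\sup_D\circ Pf)$. Composite of $(f,\bar f):C\to D$ and $(g,\bar g):D\to E$ is $g\circ f$ with the path obtained by concatenating $g\circ\bar f$, $\bar g\circ Pf$, and the canonical path $\mathsf{Id}(Pg\circ Pf,P(g\circ f))$ whiskered by $\sup_E$; the identity morphism is $1_C$ with the canonical path $\mathsf{Id}(1_C\circ\sup_C,\sup_C\circ P(1_C))$ coming from $\mathsf{Id}(P(1_C),1_{PC})$. A morphism $f:C\to D$ is a $P$-algebra equivalence if $\mathsf{isalgequiv}(f):=(\Sigma g:\mathsf{Alg}(D,C))\mathsf{Id}_{\mathsf{Alg}(C,C)}(gf,1_C)\times(\Sigma h:\mathsf{Alg}(D,C))\mathsf{Id}_{\mathsf{Alg}(D,D)}(fh,1_D)$ is inhabited. $\mathsf{ishinit}(C):=(\Pi D:\mathsf{Alg})\mathsf{iscontr}(\mathsf{Alg}(C,D))$. A fibered $P$-algebra over $C$ is $(E,e)$ with $E:C\to\mathsf{U}$, $e:(\Pi x:A)(\Pi u:B(x)\to C)((\Pi y:B(x))E(uy))\to E(\sup_C(x,u))$; a $P$-algebra section is $f:(\Pi z:C)E(z)$ with paths $\mathsf{Id}(f(\sup_C(x,u)),e(x,u,\lambda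 y.f(uy)))$ for all $x,u$. $C$ is inductive if every fibered $P$-algebra over $C$ has a $P$-algebra section. -}

{-# OPTIONS --without-K #-}
module Defs where

open import Level using (Level; Setω)
open import Data.Product using (Σ; _×_; _,_; proj₁; proj₂)
open import Function using (_∘_; id)
open import Relation.Binary.PropositionalEquality using (_≡_; refl; trans; cong)
open import Axiom.Extensionality.Propositional using (Extensionality)

FunExt : Setω
FunExt = ∀ {a b : Level} → Extensionality a b

iscontr : ∀ {ℓ} → Set ℓ → Set ℓ
iscontr X = Σ X (λ x → (y : X) → x ≡ y)

-- W-types (the small universe U is Set)
data W (A : Set) (B : A → Set) : Set where
  sup : (a : A) → (B a → W A B) → W A B

module _ (A : Set) (B : A → Set) where

  P : Set → Set
  P C = Σ A (λ x → B x → C)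

  Pmap : {C D : Set} → (C → D) → P C → P D
  Pmap f p = proj₁ p , f ∘ proj₂ p

  Alg : Set₁
  Alg = Σ Set (λ C → P C → C)

  Hom : Alg → Alg → Set
  Hom (C , supC) (D , supD) = Σ (C → D) (λ f → f ∘ supC ≡ supD ∘ Pmap f)

  -- composite of f : C → D and g : D → E.  The canonical path
  -- Id(Pg ∘ Pf, P(g ∘ f)) is refl here (it holds judgementally in Agda).
  comp : {C D E : Alg} → Hom C D → Hom D E → Hom C E
  comp {C , supC} {D , supD} {E , supE} (f , f̄) (g , ḡ) =
    (g ∘ f) , trans (cong (g ∘_) f̄) (cong (_∘ Pmap f) ḡ)

  -- identity morphism (canonical path is refl)
  idHom : (C : Alg) → Hom C C
  idHom (C , supC) = id , refl

  isalgequiv : {C D : Alg} → Hom C D → Set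
  isalgequiv {C} {D} f =
    Σ (Hom D C) (λ g → comp {C} {D} {C} f g ≡ idHom C)
    × Σ (Hom D C) (λ h → comp {D} {C} {D} h f ≡ idHom D)

  AlgEquiv : Alg → Alg → Set
  AlgEquiv C D = Σ (Hom C D) (λ f → isalgequiv {C} {D} f)

  ishinit : Alg → Set₁
  ishinit C = (D : Alg) → iscontr (Hom C D)

  FibStr : (C : Alg) → (proj₁ C → Set) → Set
  FibStr (C , supC) E =
    (x : A) (u : B x → C) → ((y : B x) → E (u y)) → E (supC (x , u))

  AlgSection : (C : Alg) (E : proj₁ C → Set) → FibStr C E → Set
  AlgSection (C , supC) E e =
    Σ ((z : C) → E z)
      (λ f → (x : A) (u : B x → C) → f (supC (x , u)) ≡ e x u (λ y → f (u y)))

  isInductive : Alg → Set₁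
  isInductive C = (E : proj₁ C → Set) (e : FibStr C E) → AlgSection C E e

  supW : P (W A B) → W A B
  supW p = sup (proj₁ p) (proj₂ p)

  WAlg : Alg
  WAlg = W A B , supW

{-# OPTIONS --without-K #-}
module Submission where

open import Defs
open import Data.Product using (_×_; Σ; _,_; proj₁; proj₂)
open import Function using (_∘_)
open import Function.Bundles using (_⇔_; mk⇔)
open import Level using (Level)
open import Relation.Binary.PropositionalEquality
open import Relation.Binary.PropositionalEquality.Properties
  using (trans-reflʳ; trans-assoc; trans-symˡ; cong-id; cong-∘; trans-cong; subst-subst; subst-∘; dcong)

-- An inductive algebra C is h-initial: the constant fibred algebra D gives a morphism C → D,
-- and the fibred algebra of paths f z ≡ g z between two morphisms gives an algebra homotopy
-- between them, which by function extensionality is a path of morphisms.  Conversely, if C is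
-- h-initial and E is fibred over C, the total space Σ C E is an algebra over C; the unique
-- morphism C → Σ C E followed by the projection equals the identity of C, and transporting the
-- second component along the resulting homotopy yields an algebra section.  W is inductive by its
-- eliminator, hence h-initial; h-initial algebras are equivalent to each other, and h-initiality
-- passes to algebra retracts.

private
  variable
    a b c d : Level

iscontr⇒≡ : {X : Set a} → iscontr X → (x y : X) → x ≡ y
iscontr⇒≡ (centre , contraction) x y = trans (sym (contraction x)) (contraction y)

iscontr-retract : {X : Set a} {Y : Set b} (r : X → Y) (s : Y → X) →
  ((y : Y) → r (s y) ≡ y) → iscontr X → iscontr Y
iscontr-retract r s rs (centre , contraction) =
  r centre , λ y → trans (cong r (contraction (s y))) (rs y)

singleton-path : {X : Set a} {x y : X} (p : x ≡ y) →
  _≡_ {A = Σ X (x ≡_)} (x , refl) (y , p)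
singleton-path refl = refl

Σ-≡,square→≡ : {X : Set a} {Y : Set b} {F G : X → Y} {x y : X} (p : x ≡ y)
  {e : F x ≡ G x} {e′ : F y ≡ G y} → trans e (cong G p) ≡ trans (cong F p) e′ →
  _≡_ {A = Σ X (λ z → F z ≡ G z)} (x , e) (y , e′)
Σ-≡,square→≡ {x = x} refl {e} square = cong (x ,_) (trans (sym (trans-reflʳ e)) square)

trans-sym-cancelʳ : {X : Set a} {x y z : X} {p : x ≡ z} {q : y ≡ z} {r : x ≡ y} →
  r ≡ trans p (sym q) → trans r q ≡ p
trans-sym-cancelʳ {p = p} {q = refl} {r} eq = trans (trans-reflʳ r) (trans eq (trans-reflʳ p))

cong-app-trans : {X : Set a} {Y : X → Set b} {f g h : (x : X) → Y x}
  (p : f ≡ g) (q : g ≡ h) (x : X) → cong-app (trans p q) x ≡ trans (cong-app p x) (cong-app q x)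
cong-app-trans refl q x = refl

cong-app-cong : {X : Set a} {Y : Set b} {Z : Set c} {V : Set d} (Φ : (X → Y) → (V → Z))
  {φ ψ : X → Y} (p : φ ≡ ψ) (v : V) → cong-app (cong Φ p) v ≡ cong (λ χ → Φ χ v) p
cong-app-cong Φ refl v = refl

cong-app-precomp : {X : Set a} {Y : Set b} {Z : Set c} (s : X → Y) {φ ψ : Y → Z}
  (p : φ ≡ ψ) (x : X) → cong-app (cong (_∘ s) p) x ≡ cong-app p (s x)
cong-app-precomp s refl x = refl

cong-app-postcomp : {X : Set a} {Y : Set b} {Z : Set c} (g : Y → Z) {φ ψ : X → Y}
  (p : φ ≡ ψ) (x : X) → cong-app (cong (g ∘_) p) x ≡ cong g (cong-app p x)
cong-app-postcomp g refl x = refl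

subst-FibStr : (A : Set) (B : A → Set) (C : Alg A B) (E : proj₁ C → Set) (e : FibStr A B C E)
  (x : A) {u₁ u₂ : B x → proj₁ C} (H : u₁ ≡ u₂) (w : (y : B x) → E (u₁ y)) →
  subst E (cong (λ v → proj₂ C (x , v)) H) (e x u₁ w) ≡ e x u₂ (λ y → subst E (cong-app H y) (w y))
subst-FibStr A B C E e x refl w = refl

module _ (fe : FunExt) where

  module _ {X : Set a} {Y : X → Set b} where

    -- Normalised so that the trivial homotopy is sent to refl.
    funext : {f g : (x : X) → Y x} → ((x : X) → f x ≡ g x) → f ≡ g
    funext {f} h = trans (sym (fe {f = f} (λ _ → refl))) (fe h)

    funext-refl : (f : (x : X) → Y x) → funext (λ x → refl {x = f x}) ≡ refl
    funext-refl f = trans-symˡ (fe (λ _ → refl))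

    homotopy-singleton : (f g : (x : X) → Y x) (h : (x : X) → f x ≡ g x) →
      _≡_ {A = Σ ((x : X) → Y x) (λ g → (x : X) → f x ≡ g x)} (f , λ _ → refl) (g , h)
    homotopy-singleton f g h =
      cong (λ k → proj₁ ∘ k , proj₂ ∘ k) (fe (λ x → singleton-path (h x)))

    cong-app-funext : {f g : (x : X) → Y x} (h : (x : X) → f x ≡ g x) → cong-app (funext h) ≡ h
    cong-app-funext {f} {g} h =
      subst (λ (g , h) → cong-app (funext h) ≡ h) (homotopy-singleton f g h)
            (cong cong-app (funext-refl f))

    funext-cong-app : {f g : (x : X) → Y x} (p : f ≡ g) → funext (cong-app p) ≡ p
    funext-cong-app {f} refl = funext-refl f

    cong-app-injective : {f g : (x : X) → Y x} {p q : f ≡ g} →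
      ((x : X) → cong-app p x ≡ cong-app q x) → p ≡ q
    cong-app-injective {p = p} {q} H =
      trans (sym (funext-cong-app p)) (trans (cong funext (fe H)) (funext-cong-app q))

  funext-precomp : {X : Set a} {Y : Set b} {Z : Set c} (s : X → Y) {φ ψ : Y → Z}
    (h : (y : Y) → φ y ≡ ψ y) → cong (_∘ s) (funext h) ≡ funext (h ∘ s)
  funext-precomp s h = cong-app-injective λ x →
    trans (cong-app-precomp s (funext h) x)
          (trans (cong-app (cong-app-funext h) (s x)) (sym (cong-app (cong-app-funext (h ∘ s)) x)))

  module _ (A : Set) (B : A → Set) {C D : Set} {sC : P A B C → C} {sD : P A B D → D} where

    AlgHomotopy : (F G : Hom A B (C , sC) (D , sD)) → Set
    AlgHomotopy (f , f̄) (g , ḡ) =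
      Σ ((z : C) → f z ≡ g z) λ h → (x : A) (u : B x → C) →
        trans (cong-app f̄ (x , u)) (cong (λ v → sD (x , v)) (funext (h ∘ u)))
          ≡ trans (h (sC (x , u))) (cong-app ḡ (x , u))

    AlgHomotopy⇒≡ : (F G : Hom A B (C , sC) (D , sD)) → AlgHomotopy F G → F ≡ G
    AlgHomotopy⇒≡ (f , f̄) (g , ḡ) (h , coh) =
      Σ-≡,square→≡ {F = _∘ sC} {G = λ φ → sD ∘ Pmap A B φ} (funext h) (cong-app-injective square)
      where
      open ≡-Reasoning
      square : (a : P A B C) →
        cong-app (trans f̄ (cong (λ φ → sD ∘ Pmap A B φ) (funext h))) a
          ≡ cong-app (trans (cong (_∘ sC) (funext h)) ḡ) a
      square (x , u) = begin
        cong-app (trans f̄ (cong (λ φ → sD ∘ Pmap A B φ) (funext h))) (x , u)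
          ≡⟨ cong-app-trans f̄ _ (x , u) ⟩
        trans (cong-app f̄ (x , u)) (cong-app (cong (λ φ → sD ∘ Pmap A B φ) (funext h)) (x , u))
          ≡⟨ cong (trans (cong-app f̄ (x , u))) (trans (cong-app-cong _ (funext h) (x , u))
               (trans (cong-∘ (funext h)) (cong (cong (λ v → sD (x , v))) (funext-precomp u h)))) ⟩
        trans (cong-app f̄ (x , u)) (cong (λ v → sD (x , v)) (funext (h ∘ u)))
          ≡⟨ coh x u ⟩
        trans (h (sC (x , u))) (cong-app ḡ (x , u))
          ≡⟨ cong (λ r → trans r (cong-app ḡ (x , u))) (sym (trans
               (cong-app-precomp sC (funext h) (x , u)) (cong-app (cong-app-funext h) (sC (x , u))))) ⟩
        trans (cong-app (cong (_∘ sC) (funext h)) (x , u)) (cong-app ḡ (x , u))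
          ≡⟨ sym (cong-app-trans _ ḡ (x , u)) ⟩
        cong-app (trans (cong (_∘ sC) (funext h)) ḡ) (x , u) ∎

    ≡⇒AlgHomotopy : (F G : Hom A B (C , sC) (D , sD)) → F ≡ G → AlgHomotopy F G
    ≡⇒AlgHomotopy (f , f̄) _ refl = (λ _ → refl) , λ x u →
      trans (cong (λ r → trans (cong-app f̄ (x , u)) (cong (λ v → sD (x , v)) r)) (funext-refl (f ∘ u)))
            (trans-reflʳ _)

  isInductive⇒ishinit : (A : Set) (B : A → Set) (C : Alg A B) → isInductive A B C → ishinit A B C
  isInductive⇒ishinit A B (C , sC) ind (D , sD) = F , unique
    where
    rec : AlgSection A B (C , sC) (λ _ → D) (λ x u v → sD (x , v))
    rec = ind (λ _ → D) (λ x u v → sD (x , v))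

    f : C → D
    f = proj₁ rec

    f̄ : f ∘ sC ≡ sD ∘ Pmap A B f
    f̄ = funext (λ (x , u) → proj₂ rec x u)

    F : Hom A B (C , sC) (D , sD)
    F = f , f̄

    unique : (G : Hom A B (C , sC) (D , sD)) → F ≡ G
    unique (g , ḡ) = AlgHomotopy⇒≡ A B F (g , ḡ) (h , coh)
      where
      paths : FibStr A B (C , sC) (λ z → f z ≡ g z)
      paths x u v = trans (trans (cong-app f̄ (x , u)) (cong (λ w → sD (x , w)) (funext v)))
                          (sym (cong-app ḡ (x , u)))
      h : (z : C) → f z ≡ g z
      h = proj₁ (ind _ paths)
      coh : (x : A) (u : B x → C) →
        trans (cong-app f̄ (x , u)) (cong (λ v → sD (x , v)) (funext (h ∘ u)))
          ≡ trans (h (sC (x , u))) (cong-app ḡ (x , u))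
      coh x u = sym (trans-sym-cancelʳ (proj₂ (ind _ paths) x u))

  ishinit⇒isInductive : (A : Set) (B : A → Set) (C : Alg A B) → ishinit A B C → isInductive A B C
  ishinit⇒isInductive A B (C , sC) hC E e = σ , σ-sup
    where
    total : Alg A B
    total = Σ C E , λ (x , t) → sC (x , proj₁ ∘ t) , e x (proj₁ ∘ t) (proj₂ ∘ t)

    π : Hom A B total (C , sC)
    π = proj₁ , refl

    k : Hom A B (C , sC) total
    k = proj₁ (hC total)

    k₁ : C → Σ C E
    k₁ = proj₁ k

    k̄ : k₁ ∘ sC ≡ proj₂ total ∘ Pmap A B k₁
    k̄ = proj₂ k

    πk : Hom A B (C , sC) (C , sC)
    πk = comp A B {C , sC} {total} {C , sC} k π

    πk∼id : AlgHomotopy A B {sC = sC} {sD = sC} πk (idHom A B (C , sC))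
    πk∼id = ≡⇒AlgHomotopy A B πk (idHom A B (C , sC)) (iscontr⇒≡ (hC (C , sC)) _ _)

    h : (z : C) → proj₁ (k₁ z) ≡ z
    h = proj₁ πk∼id

    σ : (z : C) → E z
    σ z = subst E (h z) (proj₂ (k₁ z))

    σ-sup : (x : A) (u : B x → C) → σ (sC (x , u)) ≡ e x u (λ y → σ (u y))
    σ-sup x u = begin
      subst E (h (sC (x , u))) (proj₂ (k₁ (sC (x , u))))
        ≡⟨ cong (λ r → subst E r (proj₂ (k₁ (sC (x , u))))) h-sup ⟩
      subst E (trans (cong proj₁ K) (cong (λ v → sC (x , v)) H)) (proj₂ (k₁ (sC (x , u))))
        ≡⟨ sym (subst-subst (cong proj₁ K)) ⟩
      subst E (cong (λ v → sC (x , v)) H) (subst E (cong proj₁ K) (proj₂ (k₁ (sC (x , u)))))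
        ≡⟨ cong (subst E (cong (λ v → sC (x , v)) H)) (trans (sym (subst-∘ K)) (dcong proj₂ K)) ⟩
      subst E (cong (λ v → sC (x , v)) H) (e x (proj₁ ∘ k₁ ∘ u) (proj₂ ∘ k₁ ∘ u))
        ≡⟨ subst-FibStr A B (C , sC) E e x H (proj₂ ∘ k₁ ∘ u) ⟩
      e x u (λ y → subst E (cong-app H y) (proj₂ (k₁ (u y))))
        ≡⟨ cong (λ φ → e x u (λ y → subst E (φ y) (proj₂ (k₁ (u y))))) (cong-app-funext (h ∘ u)) ⟩
      e x u (λ y → σ (u y)) ∎
      where
      open ≡-Reasoning
      K : k₁ (sC (x , u)) ≡ proj₂ total (x , k₁ ∘ u)
      K = cong-app k̄ (x , u)
      H : proj₁ ∘ k₁ ∘ u ≡ u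
      H = funext (h ∘ u)
      h-sup : h (sC (x , u)) ≡ trans (cong proj₁ K) (cong (λ v → sC (x , v)) H)
      h-sup = begin
        h (sC (x , u))
          ≡⟨ sym (trans-reflʳ _) ⟩
        trans (h (sC (x , u))) refl
          ≡⟨ sym (proj₂ πk∼id x u) ⟩
        trans (cong-app (trans (cong (proj₁ ∘_) k̄) refl) (x , u)) (cong (λ v → sC (x , v)) H)
          ≡⟨ cong (λ r → trans (cong-app r (x , u)) (cong (λ v → sC (x , v)) H)) (trans-reflʳ (cong (proj₁ ∘_) k̄)) ⟩
        trans (cong-app (cong (proj₁ ∘_) k̄) (x , u)) (cong (λ v → sC (x , v)) H)
          ≡⟨ cong (λ r → trans r (cong (λ v → sC (x , v)) H)) (cong-app-postcomp proj₁ k̄ (x , u)) ⟩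
        trans (cong proj₁ K) (cong (λ v → sC (x , v)) H) ∎

module _ (A : Set) (B : A → Set) where

  W-isInductive : isInductive A B (WAlg A B)
  W-isInductive E e = rec , λ x u → refl
    where
    rec : (w : W A B) → E w
    rec (sup x u) = e x u (λ y → rec (u y))

  comp-identityˡ : (C D : Alg A B) (F : Hom A B C D) → comp A B {C} {C} {D} (idHom A B C) F ≡ F
  comp-identityˡ C D (f , f̄) = cong (f ,_) (cong-id f̄)

  comp-assoc : (C₁ C₂ C₃ C₄ : Alg A B) (F : Hom A B C₁ C₂) (G : Hom A B C₂ C₃) (K : Hom A B C₃ C₄) →
    comp A B {C₁} {C₂} {C₄} F (comp A B {C₂} {C₃} {C₄} G K)
      ≡ comp A B {C₁} {C₃} {C₄} (comp A B {C₁} {C₂} {C₃} F G) K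
  comp-assoc C₁ C₂ C₃ C₄ (f , f̄) (g , ḡ) (k , k̄) = cong (k ∘ g ∘ f ,_) (begin
    trans (cong ((k ∘ g) ∘_) f̄) (cong (_∘ Pmap A B f) (trans (cong (k ∘_) ḡ) (cong (_∘ Pmap A B g) k̄)))
      ≡⟨ cong (trans (cong ((k ∘ g) ∘_) f̄)) (sym (trans-cong (cong (k ∘_) ḡ))) ⟩
    trans (cong ((k ∘ g) ∘_) f̄)
          (trans (cong (_∘ Pmap A B f) (cong (k ∘_) ḡ)) (cong (_∘ Pmap A B f) (cong (_∘ Pmap A B g) k̄)))
      ≡⟨ cong₂ trans (cong-∘ f̄) (cong₂ trans (trans (sym (cong-∘ ḡ)) (cong-∘ ḡ)) (sym (cong-∘ k̄))) ⟩
    trans (cong (k ∘_) (cong (g ∘_) f̄))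
          (trans (cong (k ∘_) (cong (_∘ Pmap A B f) ḡ)) (cong (_∘ Pmap A B (g ∘ f)) k̄))
      ≡⟨ sym (trans-assoc (cong (k ∘_) (cong (g ∘_) f̄))) ⟩
    trans (trans (cong (k ∘_) (cong (g ∘_) f̄)) (cong (k ∘_) (cong (_∘ Pmap A B f) ḡ)))
          (cong (_∘ Pmap A B (g ∘ f)) k̄)
      ≡⟨ cong (λ r → trans r (cong (_∘ Pmap A B (g ∘ f)) k̄)) (trans-cong (cong (g ∘_) f̄)) ⟩
    trans (cong (k ∘_) (trans (cong (g ∘_) f̄) (cong (_∘ Pmap A B f) ḡ))) (cong (_∘ Pmap A B (g ∘ f)) k̄) ∎)
    where open ≡-Reasoning

  ishinit⇒AlgEquiv : (C D : Alg A B) → ishinit A B C → ishinit A B D → AlgEquiv A B C D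
  ishinit⇒AlgEquiv C D hC hD =
    f , (g , iscontr⇒≡ (hC C) _ _) , (g , iscontr⇒≡ (hD D) _ _)
    where
    f : Hom A B C D
    f = proj₁ (hC D)
    g : Hom A B D C
    g = proj₁ (hD C)

  AlgEquiv⇒ishinit : (C D : Alg A B) → AlgEquiv A B C D → ishinit A B D → ishinit A B C
  AlgEquiv⇒ishinit C D (f , (g , gf≡id) , _) hD E =
    iscontr-retract (comp A B {C} {D} {E} f) (comp A B {D} {C} {E} g) retraction (hD E)
    where
    retraction : (K : Hom A B C E) → comp A B {C} {D} {E} f (comp A B {D} {C} {E} g K) ≡ K
    retraction K = trans (comp-assoc C D C E f g K)
                         (trans (cong (λ F → comp A B {C} {C} {E} F K) gf≡id) (comp-identityˡ C E K))

corollary5p12 : FunExt → (A : Set) (B : A → Set) →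
    ((C : Alg A B) →
      (isInductive A B C ⇔ ishinit A B C)
      × (ishinit A B C ⇔ AlgEquiv A B C (WAlg A B)))
    × ishinit A B (WAlg A B)
corollary5p12 fe A B =
  (λ C → mk⇔ (isInductive⇒ishinit fe A B C) (ishinit⇒isInductive fe A B C)
       , mk⇔ (λ hC → ishinit⇒AlgEquiv A B C (WAlg A B) hC W-ishinit)
             (λ C≃W → AlgEquiv⇒ishinit A B C (WAlg A B) C≃W W-ishinit))
  , W-ishinit
  where
  W-ishinit : ishinit A B (WAlg A B)
  W-ishinit = isInductive⇒ishinit fe A B (WAlg A B) (W-isInductive A B)
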